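{- For any tree $T$ of order at least $3$, the Connected-compelling chromatic number of $T$ equals $1+\mathrm{int}(T)$, where $\mathrm{int}(T)$ is the number of interior (non-leaf) vertices of $T$.
   Context: A proper coloring partitions the vertex set into nonempty independent color classes; a rainbow committee (RC) is a set consisting of exactly one vertex of each color. A proper coloring is Connected-compelling if every RC induces a connected subgraph; the Connected-compelling chromatic number is the minimum number of colors in such a coloring. -}

module Defs where

open import Data.Nat using (ℕ; zero; suc; _≤_; _≟_)
open import Data.Bool using (Bool; true; false)
open import Data.Fin using (Fin; inject₁; fromℕ)
open import Data.List using (List; length; filter; allFin)
open import Data.Product using (Σ; ∃; _×_)
open import Data.Unit using (⊤)
open import Relation.Nullary using (¬_)
open import Relation.Nullary.Decidable using (¬?)
open import Relation.Binary.PropositionalEquality using (_≡_; _≢_)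
open import Function.Definitions using (Injective; Surjective)

record Graph (n : ℕ) : Set where
  field
    adj     : Fin n → Fin n → Bool
    symm    : ∀ u v → adj u v ≡ adj v u
    irrefl  : ∀ v → adj v v ≡ false

open Graph public

Adj : ∀ {n} → Graph n → Fin n → Fin n → Set
Adj G u v = adj G u v ≡ true

data WalkIn {n : ℕ} (G : Graph n) (S : Fin n → Set) : Fin n → Fin n → Set where
  here : ∀ {u} → S u → WalkIn G S u u
  step : ∀ {u w v} → S u → Adj G u w → WalkIn G S w v → WalkIn G S u v

InducedConnected : ∀ {n} → Graph n → (Fin n → Set) → Set
InducedConnected G S = ∀ u v → S u → S v → WalkIn G S u v

Connected : ∀ {n} → Graph n → Set
Connected G = InducedConnected G (λ _ → ⊤)

record Cycle {n : ℕ} (G : Graph n) : Set where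
  field
    len    : ℕ
    vert   : Fin (suc (suc (suc len))) → Fin n
    inj    : Injective _≡_ _≡_ vert
    consec : ∀ (i : Fin (suc (suc len))) → Adj G (vert (inject₁ i)) (vert (Fin.suc i))
    close  : Adj G (vert (fromℕ (suc (suc len)))) (vert Fin.zero)

Acyclic : ∀ {n} → Graph n → Set
Acyclic G = ¬ Cycle G

IsTree : ∀ {n} → Graph n → Set
IsTree G = Connected G × Acyclic G

degree : ∀ {n} → Graph n → Fin n → ℕ
degree {n} G v = length (filter (λ u → adj G v u Data.Bool.≟ true) (allFin n))

int : ∀ {n} → Graph n → ℕ
int {n} G = length (filter (λ v → ¬? (degree G v ≟ 1)) (allFin n))

record ProperColoring {n : ℕ} (G : Graph n) (k : ℕ) : Set where
  field
    col      : Fin n → Fin k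
    onto     : Surjective _≡_ _≡_ col
    proper   : ∀ u v → Adj G u v → col u ≢ col v

open ProperColoring public

RainbowCommittee : ∀ {n k} {G : Graph n} → ProperColoring G k → Set
RainbowCommittee {n} {k} c = Σ (Fin k → Fin n) (λ r → ∀ i → col c (r i) ≡ i)

RCSet : ∀ {n k} {G : Graph n} {c : ProperColoring G k} → RainbowCommittee c → Fin n → Set
RCSet {k = k} (r Data.Product., _) v = ∃ λ (i : Fin k) → r i ≡ v

ConnectedCompelling : ∀ {n k} {G : Graph n} → ProperColoring G k → Set
ConnectedCompelling {G = G} c = ∀ (R : RainbowCommittee c) → InducedConnected G (RCSet {c = c} R)

HasCCColoring : ∀ {n} → Graph n → ℕ → Set
HasCCColoring G k = Σ (ProperColoring G k) ConnectedCompelling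

IsCCChromaticNumber : ∀ {n} → Graph n → ℕ → Set
IsCCChromaticNumber G k = HasCCColoring G k × (∀ k′ → HasCCColoring G k′ → k ≤ k′)

-- Colour every interior vertex with its own colour and all leaves with one further colour.  Two leaves
-- are never adjacent when n ≥ 3, so this is proper; a rainbow committee then consists of all interior
-- vertices, which are joined by paths through interior vertices only, plus one leaf attached to one of
-- them.  Conversely, in a Connected-compelling colouring an interior vertex v is alone in its colour
-- class: if w ≠ v had v's colour, let x be the last vertex before v on the path from w and u another
-- neighbour of v; a committee containing u and w avoids v, and its walk from u to w followed by the path
-- from w to x would close a cycle through v.  Since a tree has a leaf, whose colour is then unused by
-- interior vertices, at least 1 + int(T) colours are needed.
module Submission where

open import Defs
open import Data.Nat using (ℕ; zero; suc; _≤_; s≤s)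
import Data.Nat as ℕ
import Data.Nat.Properties as ℕ
open import Data.Fin as Fin using (Fin; inject₁; fromℕ)
open import Data.Fin.Properties using (injective⇒≤; suc-injective)
import Data.Bool as Bool
open import Data.List using (List; []; _∷_; length; filter; allFin; lookup)
open import Data.List.Relation.Unary.All as All using (All; []; _∷_)
open import Data.List.Relation.Unary.Any as Any using (here; there)
open import Data.List.Relation.Unary.All.Properties using (¬Any⇒All¬)
open import Data.List.Relation.Unary.Any.Properties using (lookup-index)
open import Data.List.Relation.Unary.AllPairs using ([]; _∷_)
open import Data.List.Relation.Unary.Unique.Propositional using (Unique)
open import Data.List.Relation.Unary.Unique.Propositional.Properties as Unique using (allFin⁺)
open import Data.List.Membership.Propositional using (_∈_; _∉_)
open import Data.List.Membership.Propositional.Properties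
  using (∈-lookup; ∈-filter⁺; ∈-filter⁻; ∈-allFin)
import Data.List.Membership.DecPropositional as DecMembership
open import Data.Product using (Σ; ∃; _×_; _,_; proj₁; proj₂)
open import Data.Sum using (_⊎_; inj₁; inj₂)
open import Data.Empty using (⊥-elim)
open import Data.Unit using (tt)
open import Function using (_∘_)
open import Relation.Nullary using (¬_; Dec; yes; no)
open import Relation.Nullary.Decidable using (¬?)
open import Relation.Binary.Definitions using (DecidableEquality)
open import Relation.Binary.PropositionalEquality 
  using (_≡_; _≢_; refl; sym; trans; cong; subst; ≢-sym; module ≡-Reasoning)

module _ {A : Set} where

  lookup-injective : ∀ {xs : List A} → Unique xs → ∀ i j → lookup xs i ≡ lookup xs j → i ≡ j
  lookup-injective (_ ∷ _) Fin.zero Fin.zero _ = refl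
  lookup-injective (x∉ ∷ _) Fin.zero (Fin.suc j) eq = ⊥-elim (All.lookup x∉ (∈-lookup j) eq)
  lookup-injective (x∉ ∷ _) (Fin.suc i) Fin.zero eq = ⊥-elim (All.lookup x∉ (∈-lookup i) (sym eq))
  lookup-injective (_ ∷ u) (Fin.suc i) (Fin.suc j) eq = cong Fin.suc (lookup-injective u i j eq)

  injective-on⇒length≤ : ∀ {k} {xs : List A} (f : A → Fin k) → Unique xs →
                         (∀ {x y} → x ∈ xs → y ∈ xs → f x ≡ f y → x ≡ y) → length xs ≤ k
  injective-on⇒length≤ f u inj =
    injective⇒≤ λ {i} {j} eq → lookup-injective u i j (inj (∈-lookup i) (∈-lookup j) eq)

  length≡1⇒≡ : ∀ {xs : List A} {x y} → length xs ≡ 1 → x ∈ xs → y ∈ xs → x ≡ y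
  length≡1⇒≡ {_ ∷ []} _ (here refl) (here refl) = refl

  length≢1⇒∃≢ : ∀ {xs : List A} {x} → Unique xs → length xs ≢ 1 → x ∈ xs →
                ∃ λ y → y ∈ xs × y ≢ x
  length≢1⇒∃≢ {_ ∷ []} _ len≢1 _ = ⊥-elim (len≢1 refl)
  length≢1⇒∃≢ {_ ∷ z ∷ _} ((x≢z ∷ _) ∷ _) _ (here refl) =
    z , there (here refl) , ≢-sym x≢z
  length≢1⇒∃≢ {y ∷ _ ∷ _} (y∉ ∷ _) _ (there x∈) = y , here refl , All.lookup y∉ x∈

unique⇒length≤ : ∀ {n} {xs : List (Fin n)} → Unique xs → length xs ≤ n
unique⇒length≤ u = injective-on⇒length≤ (λ x → x) u (λ _ _ eq → eq)

other-than : ∀ {n} → 2 ≤ n → (v : Fin n) → ∃ λ z → z ≢ v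
other-than (s≤s (s≤s _)) Fin.zero = Fin.suc Fin.zero , λ ()
other-than (s≤s (s≤s _)) (Fin.suc _) = Fin.zero , λ ()

other-than-both : ∀ {n} → 3 ≤ n → (u v : Fin n) → ∃ λ z → z ≢ u × z ≢ v
other-than-both (s≤s (s≤s (s≤s _))) Fin.zero Fin.zero = Fin.suc Fin.zero , (λ ()) , (λ ())
other-than-both (s≤s 2≤m) Fin.zero (Fin.suc v) =
  let z , z≢v = other-than 2≤m v in Fin.suc z , (λ ()) , z≢v ∘ suc-injective
other-than-both (s≤s 2≤m) (Fin.suc u) Fin.zero =
  let z , z≢u = other-than 2≤m u in Fin.suc z , z≢u ∘ suc-injective , (λ ())
other-than-both (s≤s _) (Fin.suc _) (Fin.suc _) = Fin.zero , (λ ()) , (λ ())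

module Position {A : Set} (_≟_ : DecidableEquality A) (xs : List A) where
  open DecMembership _≟_ using (_∈?_)

  position : A → Fin (suc (length xs))
  position v with v ∈? xs
  ... | yes v∈ = Fin.suc (Any.index v∈)
  ... | no _ = Fin.zero

  position-∉ : ∀ {v} → v ∉ xs → position v ≡ Fin.zero
  position-∉ {v} v∉ with v ∈? xs
  ... | yes v∈ = ⊥-elim (v∉ v∈)
  ... | no _ = refl

  position-∈ : ∀ {v} → v ∈ xs → ∃ λ i → position v ≡ Fin.suc i
  position-∈ {v} v∈ with v ∈? xs
  ... | yes v∈′ = Any.index v∈′ , refl
  ... | no v∉ = ⊥-elim (v∉ v∈)

  lookup-position : ∀ {v i} → position v ≡ Fin.suc i → lookup xs i ≡ v
  lookup-position {v} pos≡ with v ∈? xs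
  ... | yes v∈ with refl ← pos≡ = sym (lookup-index v∈)
  ... | no _ with () ← pos≡

  position-lookup : Unique xs → ∀ i → position (lookup xs i) ≡ Fin.suc i
  position-lookup u i with position-∈ (∈-lookup i)
  ... | j , pos≡ = trans pos≡ (cong Fin.suc (lookup-injective u j i (lookup-position pos≡)))

  position-injective-on : ∀ {u v} → v ∈ xs → position u ≡ position v → u ≡ v
  position-injective-on v∈ pos≡ with position-∈ v∈
  ... | j , pos-v = trans (sym (lookup-position (trans pos≡ pos-v))) (lookup-position pos-v)

module _ {n : ℕ} (G : Graph n) where

  open DecMembership (Fin._≟_ {n}) using (_∈?_)

  Adj-sym : ∀ {u v} → Adj G u v → Adj G v u
  Adj-sym {u} {v} uv = trans (symm G v u) uv

  Adj-irrefl : ∀ {v} → ¬ Adj G v v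
  Adj-irrefl {v} vv with trans (sym vv) (irrefl G v)
  ... | ()

  Adj⇒≢ : ∀ {u v} → Adj G u v → u ≢ v
  Adj⇒≢ uv refl = Adj-irrefl uv

  adjacent? : ∀ v u → Dec (Adj G v u)
  adjacent? v u = adj G v u Bool.≟ Bool.true

  neighbours : Fin n → List (Fin n)
  neighbours v = filter (adjacent? v) (allFin n)

  ∈-neighbours⁺ : ∀ {v u} → Adj G v u → u ∈ neighbours v
  ∈-neighbours⁺ {v} {u} = ∈-filter⁺ (adjacent? v) (∈-allFin u)

  ∈-neighbours⁻ : ∀ {v u} → u ∈ neighbours v → Adj G v u
  ∈-neighbours⁻ {v} = proj₂ ∘ ∈-filter⁻ (adjacent? v) {xs = allFin n}

  neighbours-unique : ∀ v → Unique (neighbours v)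
  neighbours-unique v = Unique.filter⁺ (adjacent? v) (allFin⁺ n)

  Leaf : Fin n → Set
  Leaf v = degree G v ≡ 1

  Interior : Fin n → Set
  Interior v = ¬ Leaf v

  leaf-or-interior : ∀ v → Leaf v ⊎ Interior v
  leaf-or-interior v with degree G v ℕ.≟ 1
  ... | yes leaf = inj₁ leaf
  ... | no interior = inj₂ interior

  interior? : ∀ v → Dec (Interior v)
  interior? v = ¬? (degree G v ℕ.≟ 1)

  interiors : List (Fin n)
  interiors = filter interior? (allFin n)

  ∈-interiors⁺ : ∀ {v} → Interior v → v ∈ interiors
  ∈-interiors⁺ {v} = ∈-filter⁺ interior? (∈-allFin v)

  ∈-interiors⁻ : ∀ {v} → v ∈ interiors → Interior v
  ∈-interiors⁻ = proj₂ ∘ ∈-filter⁻ interior? {xs = allFin n}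

  leaf∉interiors : ∀ {v} → Leaf v → v ∉ interiors
  leaf∉interiors leaf v∈ = ∈-interiors⁻ v∈ leaf

  interiors-unique : Unique interiors
  interiors-unique = Unique.filter⁺ interior? (allFin⁺ n)

  leaf-neighbours-≡ : ∀ {v a b} → Leaf v → Adj G v a → Adj G v b → a ≡ b
  leaf-neighbours-≡ leaf va vb = length≡1⇒≡ leaf (∈-neighbours⁺ va) (∈-neighbours⁺ vb)

  interior-∃≢-neighbour : ∀ {v u} → Interior v → Adj G v u → ∃ λ w → Adj G v w × w ≢ u
  interior-∃≢-neighbour {v} interior vu
    with length≢1⇒∃≢ (neighbours-unique v) interior (∈-neighbours⁺ vu)
  ... | w , w∈ , w≢u = w , ∈-neighbours⁻ w∈ , w≢u

  WalkIn-map : ∀ {S S′ : Fin n → Set} {u v} → (∀ {z} → S z → S′ z) →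
               WalkIn G S u v → WalkIn G S′ u v
  WalkIn-map f (here s) = here (f s)
  WalkIn-map f (step s uw W) = step (f s) uw (WalkIn-map f W)

  _◅◅_ : ∀ {S : Fin n → Set} {u w v} → WalkIn G S u w → WalkIn G S w v → WalkIn G S u v
  here _ ◅◅ W = W
  step s uw W₁ ◅◅ W = step s uw (W₁ ◅◅ W)

  WalkIn-start : ∀ {S : Fin n → Set} {u v} → WalkIn G S u v → S u
  WalkIn-start (here s) = s
  WalkIn-start (step s _ _) = s

  WalkIn-reverse : ∀ {S : Fin n → Set} {u v} → WalkIn G S u v → WalkIn G S v u
  WalkIn-reverse (here s) = here s
  WalkIn-reverse (step s uw W) = WalkIn-reverse W ◅◅ step (WalkIn-start W) (Adj-sym uw) (here s)

  WalkIn-first-edge : ∀ {S : Fin n → Set} {u v} → WalkIn G S u v → u ≢ v → ∃ (Adj G u)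
  WalkIn-first-edge (here _) u≢v = ⊥-elim (u≢v refl)
  WalkIn-first-edge (step _ uw _) _ = _ , uw

  WalkIn-last-edge : ∀ {S : Fin n → Set} {u v} → WalkIn G S u v → u ≢ v →
                     ∃ λ x → Adj G x v × WalkIn G (_≢ v) u x
  WalkIn-last-edge (here _) u≢v = ⊥-elim (u≢v refl)
  WalkIn-last-edge {u = u} {v} (step {w = w} _ uw W) u≢v with w Fin.≟ v
  ... | yes refl = u , uw , here u≢v
  ... | no w≢v with WalkIn-last-edge W w≢v
  ...   | x , xv , W′ = x , xv , step u≢v uw W′

  data Path : Fin n → Fin n → List (Fin n) → Set where
    stop : ∀ {u} → Path u u (u ∷ [])
    edge : ∀ {u w x vs} → Adj G u w → Path w x vs → Path u x (u ∷ vs)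

  path-start∈ : ∀ {u x xs} → Path u x xs → u ∈ xs
  path-start∈ stop = here refl
  path-start∈ (edge _ _) = here refl

  path-consecutive : ∀ {u x y ys} → Path u x (y ∷ ys) → (i : Fin (length ys)) →
                     Adj G (lookup (y ∷ ys) (inject₁ i)) (lookup (y ∷ ys) (Fin.suc i))
  path-consecutive (edge uw stop) Fin.zero = uw
  path-consecutive (edge uw (edge _ _)) Fin.zero = uw
  path-consecutive (edge _ P@(edge _ _)) (Fin.suc i) = path-consecutive P i

  path-last : ∀ {u x y ys} → Path u x (y ∷ ys) → lookup (y ∷ ys) (fromℕ (length ys)) ≡ x
  path-last stop = refl
  path-last (edge _ stop) = refl
  path-last (edge _ P@(edge _ _)) = path-last P

  path→walk : ∀ {S : Fin n → Set} {u x xs} → Path u x xs → All S xs → WalkIn G S u x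
  path→walk stop (s ∷ []) = here s
  path→walk (edge uw P) (s ∷ ss) = step s uw (path→walk P ss)

  path-prefix : ∀ {S : Fin n → Set} {u x xs y} → Path u x xs → All S xs → y ∈ xs →
                WalkIn G S u y
  path-prefix stop (s ∷ []) (here refl) = here s
  path-prefix (edge _ _) (s ∷ _) (here refl) = here s
  path-prefix (edge uw P) (s ∷ ss) (there y∈) = step s uw (path-prefix P ss y∈)

  path→cycle : ∀ {a b c x ys} → Path a x (a ∷ b ∷ c ∷ ys) → Unique (a ∷ b ∷ c ∷ ys) →
               Adj G x a → Cycle G
  path→cycle {a} {b} {c} {x} {ys} P u xa = record
    { len = length ys
    ; vert = lookup (a ∷ b ∷ c ∷ ys)
    ; inj = λ {i} {j} → lookup-injective u i j
    ; consec = path-consecutive P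
    ; close = subst (λ z → Adj G z a) (sym (path-last P)) xa
    }

  record SimplePathIn (S : Fin n → Set) (u x : Fin n) : Set where
    field
      {vertices} : List (Fin n)
      path       : Path u x vertices
      unique     : Unique vertices
      within     : All S vertices

  path-suffix : ∀ {S : Fin n → Set} {w x xs y} → Path w x xs → Unique xs → All S xs → y ∈ xs →
                SimplePathIn S y x
  path-suffix P@stop U A (here refl) = record { path = P ; unique = U ; within = A }
  path-suffix P@(edge _ _) U A (here refl) = record { path = P ; unique = U ; within = A }
  path-suffix (edge _ P) (_ ∷ U) (_ ∷ A) (there y∈) = path-suffix P U A y∈

  -- Loop erasure: if the start recurs on the erased remainder, keep only the part from that recurrence on.
  walk→simplePath : ∀ {S : Fin n → Set} {u x} → WalkIn G S u x → SimplePathIn S u x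
  walk→simplePath (here s) = record { path = stop ; unique = [] ∷ [] ; within = s ∷ [] }
  walk→simplePath {u = u} (step s uw W) with walk→simplePath W
  ... | record { path = P ; unique = U ; within = A } with u ∈? _
  ...   | yes u∈ = path-suffix P U A u∈
  ...   | no u∉ = record { path = edge uw P ; unique = ¬Any⇒All¬ _ u∉ ∷ U ; within = s ∷ A }

  -- An inner vertex of a simple path has two distinct neighbours on it.
  path-interior : ∀ {u x xs} → Path u x xs → Unique xs → Interior u → Interior x → All Interior xs
  path-interior stop _ iu _ = iu ∷ []
  path-interior (edge _ stop) _ iu ix = iu ∷ ix ∷ []
  path-interior (edge uw P@(edge ww′ Q)) (u∉ ∷ U) iu ix = iu ∷ path-interior P U iw ix
    where
    iw : Interior _
    iw leaf = All.lookup u∉ (there (path-start∈ Q)) (leaf-neighbours-≡ leaf (Adj-sym uw) ww′)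

  module _ (connected : Connected G) where

    ∃-neighbour : 2 ≤ n → ∀ u → ∃ (Adj G u)
    ∃-neighbour 2≤n u =
      let z , z≢u = other-than 2≤n u in WalkIn-first-edge (connected u z tt tt) (≢-sym z≢u)

    interior-connected : InducedConnected G Interior
    interior-connected u x iu ix =
      let open SimplePathIn (walk→simplePath (connected u x tt tt))
      in path→walk path (path-interior path unique iu ix)

    -- Two adjacent leaves have no other neighbours, so a walk can never enter the edge between them.
    leaf-edge-closed : ∀ {S : Fin n → Set} {u v z t} → Leaf u → Leaf v → Adj G u v →
                       WalkIn G S z t → t ≡ u ⊎ t ≡ v → z ≡ u ⊎ z ≡ v
    leaf-edge-closed _ _ _ (here _) t∈ = t∈
    leaf-edge-closed lu lv uv (step _ zw W) t∈ with leaf-edge-closed lu lv uv W t∈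
    ... | inj₁ refl = inj₂ (leaf-neighbours-≡ lu (Adj-sym zw) uv)
    ... | inj₂ refl = inj₁ (leaf-neighbours-≡ lv (Adj-sym zw) (Adj-sym uv))

    leaves-nonadjacent : 3 ≤ n → ∀ {u v} → Leaf u → Leaf v → ¬ Adj G u v
    leaves-nonadjacent 3≤n {u} {v} lu lv uv with other-than-both 3≤n u v
    ... | z , z≢u , z≢v with leaf-edge-closed lu lv uv (connected z u tt tt) (inj₁ refl)
    ...   | inj₁ z≡u = z≢u z≡u
    ...   | inj₂ z≡v = z≢v z≡v

  module _ (acyclic : Acyclic G) where

    neighbours-separated : ∀ {v u x} → Adj G v u → Adj G v x → u ≢ x → ¬ WalkIn G (_≢ v) u x
    neighbours-separated {v} vu vx u≢x W with walk→simplePath W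
    ... | record { path = stop } = u≢x refl
    ... | record { path = P@(edge _ stop) ; unique = U ; within = A } =
      acyclic (path→cycle (edge vu P) (All.map ≢-sym A ∷ U) (Adj-sym vx))
    ... | record { path = P@(edge _ (edge _ _)) ; unique = U ; within = A } =
      acyclic (path→cycle (edge vu P) (All.map ≢-sym A ∷ U) (Adj-sym vx))

    -- A non-leaf head e of a simple path has a neighbour y other than its successor p; y cannot lie on the
    -- path (neighbours-separated), so the path grows at y.  Simple paths have at most n vertices.
    extend-to-leaf : ∀ (fuel : ℕ) {e p s ps} → Adj G e p → Path p s ps → Unique (e ∷ ps) →
                     n ≤ fuel ℕ.+ length ps → ∃ Leaf
    extend-to-leaf zero _ _ U bound = ⊥-elim (ℕ.<⇒≱ (unique⇒length≤ U) bound)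
    extend-to-leaf (suc fuel) {e} {ps = ps} ep P U@(e∉ ∷ _) bound with leaf-or-interior e
    ... | inj₁ leaf = e , leaf
    ... | inj₂ interior with interior-∃≢-neighbour interior ep
    ...   | y , ey , y≢p with y ∈? (e ∷ ps)
    ...     | yes (here refl) = ⊥-elim (Adj-irrefl ey)
    ...     | yes (there y∈) =
      ⊥-elim (neighbours-separated ep ey (≢-sym y≢p) (path-prefix P (All.map ≢-sym e∉) y∈))
    ...     | no y∉ = extend-to-leaf fuel (Adj-sym ey) (edge ep P) (¬Any⇒All¬ _ y∉ ∷ U)
                        (subst (n ≤_) (sym (ℕ.+-suc fuel (length ps))) bound)

    edge⇒∃-leaf : ∀ {u v} → Adj G u v → ∃ Leaf
    edge⇒∃-leaf uv =
      extend-to-leaf n uv stop ((Adj⇒≢ uv ∷ []) ∷ [] ∷ []) (ℕ.m≤m+n n 1)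

  module _ {k : ℕ} (c : ProperColoring G k) where

    committee-member : ∀ (R : RainbowCommittee c) {z} → RCSet {c = c} R z → proj₁ R (col c z) ≡ z
    committee-member (r , r-col) (i , refl) = cong r (r-col i)

    committee-through : ∀ {a b} → col c a ≢ col c b →
                        Σ (RainbowCommittee c) λ R → proj₁ R (col c a) ≡ a × proj₁ R (col c b) ≡ b
    committee-through {a} {b} ca≢cb = (proj₁ ∘ pick , proj₂ ∘ pick) , pick-a , pick-b
      where
      pick : (i : Fin k) → ∃ λ z → col c z ≡ i
      pick i with i Fin.≟ col c a | i Fin.≟ col c b
      ... | yes i≡ca | _ = a , sym i≡ca
      ... | no _ | yes i≡cb = b , sym i≡cb
      ... | no _ | no _ = proj₁ (onto c i) , proj₂ (onto c i) refl

      pick-a : proj₁ (pick (col c a)) ≡ a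
      pick-a with col c a Fin.≟ col c a
      ... | yes _ = refl
      ... | no ca≢ca = ⊥-elim (ca≢ca refl)

      pick-b : proj₁ (pick (col c b)) ≡ b
      pick-b with col c b Fin.≟ col c a | col c b Fin.≟ col c b
      ... | yes cb≡ca | _ = ⊥-elim (ca≢cb (sym cb≡ca))
      ... | no _ | yes _ = refl
      ... | no _ | no cb≢cb = ⊥-elim (cb≢cb refl)

  cc-interior-colour-class : IsTree G → ∀ {k} (c : ProperColoring G k) → ConnectedCompelling c →
                             ∀ {v w} → Interior v → col c w ≡ col c v → w ≡ v
  cc-interior-colour-class (connected , acyclic) c cc {v} {w} iv cw≡cv with w Fin.≟ v
  ... | yes w≡v = w≡v
  ... | no w≢v with WalkIn-last-edge (connected w v tt tt) w≢v
  ...   | x , xv , W₁ with interior-∃≢-neighbour iv (Adj-sym xv)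
  ...     | u , vu , u≢x with committee-through c (λ cu≡cw → proper c v u vu (sym (trans cu≡cw cw≡cv)))
  ...       | R , Ru , Rw = ⊥-elim (neighbours-separated acyclic vu (Adj-sym xv) u≢x (W₂ ◅◅ W₁))
    where
    v∉R : ∀ {z} → RCSet {c = c} R z → z ≢ v
    v∉R z∈R refl = w≢v (begin
      w                  ≡⟨ Rw ⟨
      proj₁ R (col c w)  ≡⟨ cong (proj₁ R) cw≡cv ⟩
      proj₁ R (col c v)  ≡⟨ committee-member c R z∈R ⟩
      v                  ∎)
      where open ≡-Reasoning

    W₂ : WalkIn G (_≢ v) u w
    W₂ = WalkIn-map v∉R (cc R u w (col c u , Ru) (col c w , Rw))

  cc-lower-bound : IsTree G → ∃ Leaf → ∀ {k} (c : ProperColoring G k) → ConnectedCompelling c →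
                   suc (int G) ≤ k
  cc-lower-bound tree (l , leaf) c cc =
    injective-on⇒length≤ (col c) (¬Any⇒All¬ _ (leaf∉interiors leaf) ∷ interiors-unique) injective
    where
    singleton : ∀ {v w} → v ∈ interiors → col c w ≡ col c v → w ≡ v
    singleton v∈ = cc-interior-colour-class tree c cc (∈-interiors⁻ v∈)
    injective : ∀ {a b} → a ∈ l ∷ interiors → b ∈ l ∷ interiors → col c a ≡ col c b → a ≡ b
    injective (here refl) (here refl) _ = refl
    injective _ (there b∈) ca≡cb = singleton b∈ ca≡cb
    injective (there a∈) (here refl) ca≡cb = sym (singleton a∈ (sym ca≡cb))

  module _ (connected : Connected G) (3≤n : 3 ≤ n) (leaf : ∃ Leaf) where

    open Position Fin._≟_ interiors

    interior-colouring : ProperColoring G (suc (int G))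
    interior-colouring = record
      { col = position
      ; onto = λ { Fin.zero → proj₁ leaf , λ { refl → position-∉ (leaf∉interiors (proj₂ leaf)) }
                 ; (Fin.suc j) → lookup interiors j , λ { refl → position-lookup interiors-unique j } }
      ; proper = adjacent-distinct
      }
      where
      adjacent-distinct : ∀ u v → Adj G u v → position u ≢ position v
      adjacent-distinct u v uv pos≡ with leaf-or-interior u | leaf-or-interior v
      ... | _ | inj₂ iv = Adj⇒≢ uv (position-injective-on (∈-interiors⁺ iv) pos≡)
      ... | inj₂ iu | _ = Adj⇒≢ uv (sym (position-injective-on (∈-interiors⁺ iu) (sym pos≡)))
      ... | inj₁ lu | inj₁ lv = leaves-nonadjacent connected 3≤n lu lv uv

    -- Interior vertices are alone in their colour class, so every committee contains all of them.
    module _ (R : RainbowCommittee interior-colouring) where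

      Member : Fin n → Set
      Member = RCSet {c = interior-colouring} R

      interior⇒member : ∀ {h} → Interior h → Member h
      interior⇒member ih = _ , position-injective-on (∈-interiors⁺ ih) (proj₂ R _)

      member⇒near-interior : ∀ {a} → Member a → ∃ λ h → Interior h × WalkIn G Member a h
      member⇒near-interior {a} a∈R with leaf-or-interior a
      ... | inj₂ ia = a , ia , here a∈R
      ... | inj₁ la with ∃-neighbour connected (ℕ.<⇒≤ 3≤n) a
      ...   | q , aq with leaf-or-interior q
      ...     | inj₁ lq = ⊥-elim (leaves-nonadjacent connected 3≤n la lq aq)
      ...     | inj₂ iq = q , iq , step a∈R aq (here (interior⇒member iq))

    interior-colouring-cc : ConnectedCompelling interior-colouring
    interior-colouring-cc R a b a∈R b∈R
      with member⇒near-interior R a∈R | member⇒near-interior R b∈R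
    ... | h₁ , i₁ , W₁ | h₂ , i₂ , W₂ =
      W₁ ◅◅ (WalkIn-map (interior⇒member R) (interior-connected connected h₁ h₂ i₁ i₂)
             ◅◅ WalkIn-reverse W₂)

mainTheorem16 : ∀ (n : ℕ) (T : Graph n) → 3 ≤ n → IsTree T →
                  IsCCChromaticNumber T (suc (int T))
mainTheorem16 (suc _) T 3≤n tree@(connected , acyclic) =
  (interior-colouring T connected 3≤n leaf , interior-colouring-cc T connected 3≤n leaf) ,
  λ k (c , cc) → cc-lower-bound T tree leaf c cc
  where
  leaf : ∃ (Leaf T)
  leaf = edge⇒∃-leaf T acyclic (proj₂ (∃-neighbour T connected (ℕ.<⇒≤ 3≤n) Fin.zero))
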